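{- Let $n \geq 5$ be an odd integer. (i) Player $A$ has a winning strategy in the game $Z(n,d)$ for every $d \in \{2,3\}$. (ii) If moreover $n \geq 11$, then Player $A$ has a winning strategy in the game $Z(n,d)$ for every $d \in \{2,3,4,5,6\}$.
   Context: For integers $n \geq 4$ and $d \geq 2$, $Z(n,d)$ is the following two-player game. Initially the board contains the numbers $1,2,\dots,n$. Players $A$ and $B$ alternately cross out (remove) one number from the board, with $A$ moving first, until exactly two numbers remain. If the sum of the two remaining numbers is divisible by $d$, $A$ wins; otherwise $B$ wins. A player has a winning strategy if that player can force a win regardless of the opponent's moves. -}

module Defs where

open import Data.Nat using (ℕ; zero; suc; _+_)
open import Data.Nat.Divisibility using (_∣_)
open import Data.List using (List; []; _∷_; length; upTo; map; removeAt)
open import Data.Nat.ListAction using (sum)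
open import Data.Fin using (Fin)
open import Data.Product using (Σ)

data Player : Set where
  PA PB : Player

board : ℕ → List ℕ
board n = map suc (upTo n)

-- ForcesWin d k p xs : Player A can force a win in the game with divisor d,
-- starting from the board xs (with exactly k + 2 numbers, i.e. k moves
-- remaining) and player p to move.
ForcesWin : ℕ → ℕ → Player → List ℕ → Set
ForcesWin d zero p xs = d ∣ sum xs
ForcesWin d (suc k) PA xs = Σ (Fin (length xs)) (λ i → ForcesWin d k PB (removeAt xs i))
ForcesWin d (suc k) PB xs = (i : Fin (length xs)) → ForcesWin d k PA (removeAt xs i)

AWinsZ : ℕ → ℕ → Set
AWinsZ n d = ForcesWin d (n Data.Nat.∸ 2) PA (board n)

-- A wins by a pairing strategy.  After her first move the board splits into pairs whose
-- sums are divisible by d and a small core on which she wins; she then answers a move of B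
-- on a pair by crossing out its partner and a move on the core by her core strategy, so the
-- last two numbers are a pair or the end of a won core game.  The 2d consecutive numbers
-- n + 1, …, n + 2d always split into d such pairs, so a win for n extends to n + 2d, and the
-- d base cases and the d residue classes of blocks are settled by a greedy matching that is
-- checked by evaluation.

module Submission where

open import Defs
open import Data.Bool using (if_then_else_)
open import Data.Fin using (Fin; toℕ; fromℕ<) renaming (zero to fzero; suc to fsuc)
open import Data.Fin.Properties using (toℕ-fromℕ<) renaming (any? to anyFin?; all? to allFin?)
open import Data.List using (List; []; _∷_; _++_; length; map; foldr; applyUpTo; removeAt; lookup; allFin; mapMaybe; head)
open import Data.List.Properties using (map-applyUpTo; length-removeAt; length-++; ≡-dec)
open import Data.List.Relation.Binary.Permutation.Propositional using (_↭_; refl; prep; swap; trans; ↭-sym; ↭-reflexive)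
open import Data.List.Relation.Binary.Permutation.Propositional.Properties using (↭-length; ++-comm; ++⁺ˡ; map⁺)
open import Data.List.Relation.Unary.All using (All; []; _∷_; all?)
import Data.List.Relation.Unary.All as All
open import Data.List.Relation.Unary.All.Properties using () renaming (map⁺ to All-map⁺)
open import Data.Nat.Properties using (_≟_; +-identityʳ; +-suc; +-comm; m+[n∸m]≡n; *-cancelˡ-≤; ≤-decTotalOrder)
open import Data.List.Sort.InsertionSort.Base ≤-decTotalOrder using (sort)
open import Data.List.Sort.InsertionSort.Properties ≤-decTotalOrder using (sort-↭)
open import Data.Maybe using (Maybe; just; nothing; from-just; _>>=_)
import Data.Maybe as Maybe
open import Data.Nat using (ℕ; zero; suc; _+_; _*_; _∸_; _≤_; s≤s; s≤s⁻¹; pred; NonZero; _%_; _/_)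
open import Data.Nat.Divisibility using (_∣_; _∣?_; ∣m∣n⇒∣m+n; n∣m*n)
open import Data.Nat.DivMod using (m≡m%n+[m/n]*n; m%n<n)
open import Data.Nat.ListAction using (sum)
open import Data.Nat.ListAction.Properties using (sum-↭)
open import Data.Nat.Tactic.RingSolver using (solve-∀)
open import Data.Product using (_×_; _,_; ∃; proj₁; proj₂)
import Data.Product as Product
open import Function using (_∘_)
open import Relation.Nullary using (Dec; does)
open import Relation.Nullary.Decidable using (dec⇒maybe)
open import Relation.Binary.PropositionalEquality using (_≡_; cong; cong₂; subst; sym; module ≡-Reasoning)
  renaming (refl to ≡-refl; trans to ≡-trans)

double : ℕ → ℕ
double zero = zero
double (suc n) = suc (suc (double n))

double-+ : ∀ m n → double (m + n) ≡ double m + double n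
double-+ zero n = ≡-refl
double-+ (suc m) n = cong (suc ∘ suc) (double-+ m n)

double≡2* : ∀ n → double n ≡ 2 * n
double≡2* zero = ≡-refl
double≡2* (suc n) = cong suc (≡-trans (cong suc (double≡2* n)) (sym (+-suc n (n + 0))))

double-injective : ∀ {m n} → double m ≡ double n → m ≡ n
double-injective {zero} {zero} _ = ≡-refl
double-injective {suc m} {suc n} eq = cong suc (double-injective (cong (pred ∘ pred) eq))

interval : ℕ → ℕ → List ℕ
interval a zero = []
interval a (suc k) = suc a ∷ interval (suc a) k

length-interval : ∀ a k → length (interval a k) ≡ k
length-interval a zero = ≡-refl
length-interval a (suc k) = cong suc (length-interval (suc a) k)

interval-+ : ∀ a k m → interval a (k + m) ≡ interval a k ++ interval (a + k) m
interval-+ a zero m = cong (λ b → interval b m) (sym (+-identityʳ a))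
interval-+ a (suc k) m =
  cong (suc a ∷_)
    (≡-trans (interval-+ (suc a) k m) (cong (λ b → interval (suc a) k ++ interval b m) (sym (+-suc a k))))

map-interval : ∀ c a k → map (c +_) (interval a k) ≡ interval (c + a) k
map-interval c a zero = ≡-refl
map-interval c a (suc k) =
  cong₂ _∷_ (+-suc c a) (≡-trans (map-interval c (suc a) k) (cong (λ b → interval b k) (+-suc c a)))

applyUpTo≡interval : ∀ (f : ℕ → ℕ) a k → (∀ i → f i ≡ suc (a + i)) → applyUpTo f k ≡ interval a k
applyUpTo≡interval f a zero _ = ≡-refl
applyUpTo≡interval f a (suc k) f≗ =
  cong₂ _∷_ (≡-trans (f≗ 0) (cong suc (+-identityʳ a)))
    (applyUpTo≡interval (f ∘ suc) (suc a) k (λ i → ≡-trans (f≗ (suc i)) (cong suc (+-suc a i))))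

board≡interval : ∀ n → board n ≡ interval 0 n
board≡interval n = ≡-trans (map-applyUpTo (λ i → i) suc n) (applyUpTo≡interval suc 0 n (λ _ → ≡-refl))

length-board : ∀ n → length (board n) ≡ n
length-board n = ≡-trans (cong length (board≡interval n)) (length-interval 0 n)

board-+ : ∀ n k → board (n + k) ≡ board n ++ interval n k
board-+ n k =
  ≡-trans (board≡interval (n + k)) (≡-trans (interval-+ 0 n k) (cong (_++ interval n k) (sym (board≡interval n))))

module _ {A : Set} where

  removeAt-↭ : ∀ {xs ys : List A} → xs ↭ ys → (i : Fin (length ys)) → ∃ λ i′ → removeAt xs i′ ↭ removeAt ys i
  removeAt-↭ refl i = i , refl
  removeAt-↭ (prep x p) fzero = fzero , p
  removeAt-↭ (prep x p) (fsuc i) = Product.map fsuc (prep x) (removeAt-↭ p i)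
  removeAt-↭ (swap x y p) fzero = fsuc fzero , prep x p
  removeAt-↭ (swap x y p) (fsuc fzero) = fzero , prep y p
  removeAt-↭ (swap x y p) (fsuc (fsuc i)) = Product.map (fsuc ∘ fsuc) (swap x y) (removeAt-↭ p i)
  removeAt-↭ (trans p q) i with removeAt-↭ q i
  ... | j , q′ = Product.map₂ (λ p′ → trans p′ q′) (removeAt-↭ p j)

  removeAt-++ˡ : ∀ (xs ys : List A) (i : Fin (length xs)) → ∃ λ j → removeAt (xs ++ ys) j ≡ removeAt xs i ++ ys
  removeAt-++ˡ (x ∷ xs) ys fzero = fzero , ≡-refl
  removeAt-++ˡ (x ∷ xs) ys (fsuc i) = Product.map fsuc (cong (x ∷_)) (removeAt-++ˡ xs ys i)

  flatten : List (A × A) → List A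
  flatten [] = []
  flatten ((a , b) ∷ ps) = a ∷ b ∷ flatten ps

  length-flatten : ∀ ps → length (flatten ps) ≡ double (length ps)
  length-flatten [] = ≡-refl
  length-flatten (_ ∷ ps) = cong (suc ∘ suc) (length-flatten ps)

  map-flatten : ∀ (f : A → A) ps → map f (flatten ps) ≡ flatten (map (Product.map f f) ps)
  map-flatten f [] = ≡-refl
  map-flatten f (_ ∷ ps) = cong (λ l → _ ∷ _ ∷ l) (map-flatten f ps)

forAllFin? : ∀ {n} {P : Fin n → Set} → ((i : Fin n) → Maybe (P i)) → Maybe ((i : Fin n) → P i)
forAllFin? {zero} f = just λ ()
forAllFin? {suc n} f = do
  p ← f fzero
  ps ← forAllFin? (f ∘ fsuc)
  just λ { fzero → p ; (fsuc i) → ps i }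

_↭?_ : (xs ys : List ℕ) → Maybe (xs ↭ ys)
xs ↭? ys = Maybe.map (λ eq → trans (↭-sym (sort-↭ xs)) (trans (↭-reflexive eq) (sort-↭ ys)))
                     (dec⇒maybe (≡-dec _≟_ (sort xs) (sort ys)))

periodic-induction : ∀ (P : ℕ → Set) p .{{_ : NonZero p}} j₀ → (∀ j → P j → P (p + j)) →
                     (∀ (r : Fin p) → P (j₀ + toℕ r)) → ∀ j → j₀ ≤ j → P j
periodic-induction P p j₀ step base j j₀≤j =
  subst P (≡-trans (cong (j₀ +_) (sym (m≡m%n+[m/n]*n k p))) (m+[n∸m]≡n j₀≤j)) (iterate (k / p))
  where
  k = j ∸ j₀
  r = k % p
  iterate : ∀ q → P (j₀ + (r + q * p))
  iterate zero =
    subst P (cong (j₀ +_) (≡-trans (toℕ-fromℕ< (m%n<n k p)) (sym (+-identityʳ r)))) (base (fromℕ< (m%n<n k p)))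
  iterate (suc q) = subst P (+-rearrange p j₀ r (q * p)) (step _ (iterate q))
    where
    +-rearrange : ∀ a b c e → a + (b + (c + e)) ≡ b + (c + (a + e))
    +-rearrange = solve-∀

module Game (d : ℕ) .{{_ : NonZero d}} where

  forcesWin-↭ : ∀ k p {xs ys} → xs ↭ ys → ForcesWin d k p xs → ForcesWin d k p ys
  forcesWin-↭ zero p σ w = subst (d ∣_) (sum-↭ σ) w
  forcesWin-↭ (suc k) PA σ (i , w) with removeAt-↭ (↭-sym σ) i
  ... | j , τ = j , forcesWin-↭ k PB (↭-sym τ) w
  forcesWin-↭ (suc k) PB σ w i with removeAt-↭ σ i
  ... | j , τ = forcesWin-↭ k PA τ (w j)

  forcesWin? : ∀ k p xs → Dec (ForcesWin d k p xs)
  forcesWin? zero p xs = d ∣? sum xs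
  forcesWin? (suc k) PA xs = anyFin? (λ i → forcesWin? k PB (removeAt xs i))
  forcesWin? (suc k) PB xs = allFin? (λ i → forcesWin? k PA (removeAt xs i))

  Complementary : ℕ × ℕ → Set
  Complementary (a , b) = d ∣ a + b

  complementary? : ∀ q → Dec (Complementary q)
  complementary? (a , b) = d ∣? a + b

  d∣sum[a,b] : ∀ a b → Complementary (a , b) → d ∣ sum (a ∷ b ∷ [])
  d∣sum[a,b] a b = subst (d ∣_) (cong (a +_) (sym (+-identityʳ b)))

  forcesWin-pair : ∀ j {a b xs} → Complementary (a , b) → length xs ≡ 2 + double j →
                   ForcesWin d (double j) PB xs → ForcesWin d (double (suc j)) PB (a ∷ b ∷ xs)
  forcesWin-pair j _ _ w fzero = fzero , w
  forcesWin-pair j _ _ w (fsuc fzero) = fzero , w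
  -- B crossed out one of the last two numbers of xs; A crosses out the other, leaving the pair.
  forcesWin-pair zero {a} {b} {_ ∷ _ ∷ []} d∣a+b _ _ (fsuc (fsuc fzero)) = fsuc (fsuc fzero) , d∣sum[a,b] a b d∣a+b
  forcesWin-pair zero {a} {b} {_ ∷ _ ∷ []} d∣a+b _ _ (fsuc (fsuc (fsuc fzero))) = fsuc (fsuc fzero) , d∣sum[a,b] a b d∣a+b
  forcesWin-pair zero {xs = []} _ () _ (fsuc (fsuc _))
  forcesWin-pair zero {xs = _ ∷ []} _ () _ (fsuc (fsuc _))
  forcesWin-pair zero {xs = _ ∷ _ ∷ _ ∷ _} _ () _ (fsuc (fsuc _))
  forcesWin-pair (suc j) {a} {b} {xs} d∣a+b len w (fsuc (fsuc i)) with w i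
  ... | k , w′ = fsuc (fsuc k) , forcesWin-pair j {a} {b} d∣a+b len′ w′
    where
    len′ : length (removeAt (removeAt xs i) k) ≡ 2 + double j
    len′ = ≡-trans (length-removeAt (removeAt xs i) k)
                   (cong pred (≡-trans (length-removeAt xs i) (cong pred len)))

  forcesWin-pairs : ∀ {ps j xs} → All Complementary ps → length xs ≡ 2 + double j →
                    ForcesWin d (double j) PB xs → ForcesWin d (double (length ps + j)) PB (flatten ps ++ xs)
  forcesWin-pairs [] len w = w
  forcesWin-pairs {(a , b) ∷ ps} {j} {xs} (c ∷ cs) len w =
    forcesWin-pair (length ps + j) {a} {b} c len′ (forcesWin-pairs cs len w)
    where
    open ≡-Reasoning
    len′ : length (flatten ps ++ xs) ≡ 2 + double (length ps + j)
    len′ = begin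
      length (flatten ps ++ xs)            ≡⟨ length-++ (flatten ps) ⟩
      length (flatten ps) + length xs      ≡⟨ cong₂ _+_ (length-flatten ps) len ⟩
      double (length ps) + (2 + double j)  ≡⟨ +-rearrange (double (length ps)) (double j) ⟩
      2 + (double (length ps) + double j)  ≡⟨ cong (2 +_) (sym (double-+ (length ps) j)) ⟩
      2 + double (length ps + j)           ∎
      where
      +-rearrange : ∀ m n → m + (2 + n) ≡ 2 + (m + n)
      +-rearrange = solve-∀

  PerfectPairing : List ℕ → Set
  PerfectPairing xs = ∃ λ ps → All Complementary ps × flatten ps ↭ xs

  perfectPairing-shift : ∀ {c} → d ∣ c → ∀ {xs} → PerfectPairing xs → PerfectPairing (map (c +_) xs)
  perfectPairing-shift {c} d∣c {xs} (ps , comp , arr) =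
    map (Product.map (c +_) (c +_)) ps ,
    All-map⁺ (All.map shifted comp) ,
    subst (_↭ map (c +_) xs) (map-flatten (c +_) ps) (map⁺ (c +_) arr)
    where
    shifted : ∀ {q} → Complementary q → Complementary (Product.map (c +_) (c +_) q)
    shifted {a , b} d∣a+b = subst (d ∣_) (+-rearrange c a b) (∣m∣n⇒∣m+n (∣m∣n⇒∣m+n d∣c d∣c) d∣a+b)
      where
      +-rearrange : ∀ c a b → (c + c) + (a + b) ≡ (c + a) + (c + b)
      +-rearrange = solve-∀

  perfectPairing-interval : ∀ {k} → (∀ (r : Fin d) → PerfectPairing (interval (toℕ r) k)) →
                            ∀ N → PerfectPairing (interval N k)
  perfectPairing-interval {k} pairing N = subst PerfectPairing shifted-interval
    (perfectPairing-shift (n∣m*n (N / d))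
      (subst (λ r → PerfectPairing (interval r k)) (toℕ-fromℕ< r<d) (pairing (fromℕ< r<d))))
    where
    r<d = m%n<n N d
    shifted-interval : map (N / d * d +_) (interval (N % d) k) ≡ interval N k
    shifted-interval = ≡-trans (map-interval (N / d * d) (N % d) k) (cong (λ n → interval n k)
                         (≡-trans (+-comm (N / d * d) (N % d)) (sym (m≡m%n+[m/n]*n N d))))

  aWins-extend : (∀ N → PerfectPairing (interval N (double d))) →
                 ∀ j → AWinsZ (3 + double j) d → AWinsZ (3 + double (d + j)) d
  aWins-extend pairing j (i , w)
    with pairing (3 + double j) | removeAt-++ˡ (board (3 + double j)) (interval (3 + double j) (double d)) i
  ... | ps , comp , arr | i′ , removeAt-i′ =
    subst (ForcesWin d (suc (double (d + j))) PA) (sym board-split)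
      (i′ , subst (ForcesWin d (double (d + j)) PB) (sym removeAt-i′) wins)
    where
    N = 3 + double j
    xs = removeAt (board N) i
    len : length xs ≡ 2 + double j
    len = ≡-trans (length-removeAt (board N) i) (cong pred (length-board N))
    count : length ps ≡ d
    count = double-injective
      (≡-trans (sym (length-flatten ps)) (≡-trans (↭-length arr) (length-interval N (double d))))
    wins : ForcesWin d (double (d + j)) PB (xs ++ interval N (double d))
    wins = forcesWin-↭ _ PB (trans (++-comm (flatten ps) xs) (++⁺ˡ xs arr))
             (subst (λ m → ForcesWin d (double (m + j)) PB (flatten ps ++ xs)) count (forcesWin-pairs comp len w))
    board-split : board (3 + double (d + j)) ≡ board N ++ interval N (double d)
    board-split = ≡-trans (cong (board ∘ (3 +_)) (≡-trans (double-+ d j) (+-comm (double d) (double j))))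
                          (board-+ N (double d))

  matchPartner : ℕ → List ℕ → Maybe (ℕ × List ℕ)
  matchPartner x [] = nothing
  matchPartner x (y ∷ ys) =
    if does (complementary? (x , y)) then just (y , ys) else Maybe.map (Product.map₂ (y ∷_)) (matchPartner x ys)

  greedyPairing : List ℕ → List (ℕ × ℕ) × List ℕ
  greedyPairing = foldr insert ([] , [])
    where
    insert : ℕ → List (ℕ × ℕ) × List ℕ → List (ℕ × ℕ) × List ℕ
    insert x (ps , unpaired) with matchPartner x unpaired
    ... | just (y , rest) = (x , y) ∷ ps , rest
    ... | nothing = ps , x ∷ unpaired

  perfectPairing? : ∀ xs → Maybe (PerfectPairing xs)
  perfectPairing? xs = do
    comp ← dec⇒maybe (all? complementary? ps)
    arr ← flatten ps ↭? xs
    just (ps , comp , arr)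
    where
    ps = proj₁ (greedyPairing xs)

  pairingWin? : ∀ j xs (ps : List (ℕ × ℕ)) (core : List ℕ) → Maybe (ForcesWin d (double j) PB xs)
  pairingWin? j xs ps core = do
    comp ← dec⇒maybe (all? complementary? ps)
    len ← dec⇒maybe (length core ≟ 2 + double jc)
    wcore ← dec⇒maybe (forcesWin? (double jc) PB core)
    count ← dec⇒maybe (length ps + jc ≟ j)
    arr ← (flatten ps ++ core) ↭? xs
    just (forcesWin-↭ _ PB arr
      (subst (λ m → ForcesWin d (double m) PB (flatten ps ++ core)) count (forcesWin-pairs comp len wcore)))
    where
    jc = j ∸ length ps

  pairingStrategy? : ∀ j xs → Maybe (ForcesWin d (double j) PB xs)
  pairingStrategy? j xs = head (mapMaybe withCore (allFin (length ps)))
    where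
    ps = proj₁ (greedyPairing xs)
    withCore : Fin (length ps) → Maybe (ForcesWin d (double j) PB xs)
    withCore i = pairingWin? j xs (removeAt ps i) (proj₂ (greedyPairing xs) ++ flatten (lookup ps i ∷ []))

  firstMove? : ∀ j → Maybe (AWinsZ (3 + double j) d)
  firstMove? j = head (mapMaybe (λ i → Maybe.map (i ,_) (pairingStrategy? j (removeAt (board (3 + double j)) i)))
                                (allFin _))

  oddWins : ∀ j₀ → (∀ (r : Fin d) → PerfectPairing (interval (toℕ r) (double d))) →
            (∀ (r : Fin d) → AWinsZ (3 + double (j₀ + toℕ r)) d) →
            ∀ m → suc j₀ ≤ m → AWinsZ (suc (2 * m)) d
  oddWins j₀ blocks bases (suc j) (s≤s j₀≤j) =
    subst (λ n → AWinsZ n d) (cong suc (double≡2* (suc j)))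
      (periodic-induction (λ j → AWinsZ (3 + double j) d) d j₀
        (aWins-extend (perfectPairing-interval blocks)) bases j j₀≤j)

  oddWins? : ∀ j₀ → Maybe (∀ m → suc j₀ ≤ m → AWinsZ (suc (2 * m)) d)
  oddWins? j₀ = do
    blocks ← forAllFin? (λ r → perfectPairing? (interval (toℕ r) (double d)))
    bases ← forAllFin? (λ r → firstMove? (j₀ + toℕ r))
    just (oddWins j₀ blocks bases)

half-≤ : ∀ k {m} → suc (2 * k) ≤ suc (2 * m) → k ≤ m
half-≤ k le = *-cancelˡ-≤ 2 (s≤s⁻¹ le)

theorem3p1p8 : (n : ℕ) → 5 ≤ n → ∃ (λ m → n ≡ suc (2 * m)) →
    (AWinsZ n 2 × AWinsZ n 3)
    × (11 ≤ n → AWinsZ n 2 × AWinsZ n 3 × AWinsZ n 4 × AWinsZ n 5 × AWinsZ n 6)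
theorem3p1p8 _ 5≤n (m , ≡-refl) = (wins₂ , wins₃) , λ 11≤n →
  let m≥5 = half-≤ 5 11≤n in
  wins₂ , wins₃ ,
  from-just (Game.oddWins? 4 4) m m≥5 ,
  from-just (Game.oddWins? 5 4) m m≥5 ,
  from-just (Game.oddWins? 6 4) m m≥5
  where
  wins₂ = from-just (Game.oddWins? 2 1) m (half-≤ 2 5≤n)
  wins₃ = from-just (Game.oddWins? 3 1) m (half-≤ 2 5≤n)
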